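{- In the ring $\mathbb{Z}\langle\langle X,Y\rangle\rangle$ of formal power series in non-commuting variables $X,Y$, \[ \sum_{\lambda\in C_{(2)}}M(\lambda)=\frac{1}{1-YX},\qquad \sum_{\lambda\in C_{(3)}}M(\lambda)=\frac{1}{1-YX^2}\,(1+YX)\,\frac{1}{1-Y^2X}, \] and \[ \sum_{\lambda\in C_{(4)}}M(\lambda)=\frac{1}{1-YX^3}\left(\frac{1}{1-YX}+(1+YX^2)\frac{1}{1-Y^2X^2}(1+Y^2X)-1\right)\frac{1}{1-Y^3X}, \] where $\frac{1}{1-f}=\sum_{k\ge0}f^k$ for $f$ without constant term.
   Context: A partition $\lambda=(\lambda_1,\dots,\lambda_\ell)$ is a finite weakly decreasing sequence of positive integers (the empty partition included). Its Young diagram is $\{(i,j):1\le i\le\ell,\ 1\le j\le\lambda_i\}$ and the hook length $h_{i,j}(\lambda)$ of a cell is the number of cells $(a,b)$ of the diagram with ($a=i$, $b\ge j$) or ($a\ge i$, $b=j$). For a positive integer $p$, $C_{(p)}$ is the set of $p$-core partitions, i.e. partitions having no cell with hook length equal to $p$. The partition sequence of $\lambda$ is the word $M(\lambda)=Y^{\lambda_\ell}XY^{\lambda_{\ell-1}-\lambda_\ell}X\cdots Y^{\lambda_1-\lambda_2}X$ in the letters $X,Y$ (equivalently: the word of length $h_{1,1}(\lambda)+1$ whose $t$-th letter is $X$ iff $t=h_{k,1}(\lambda)+1$ for some $k$); $M(())$ is the empty word $1$. Words are identified with monomials. -}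

module Defs where

open import Data.Nat using (ℕ; zero; suc; _∸_; _≤_; _<_; _≤?_)
open import Data.Integer using (ℤ; +_; _+_; _*_; _-_)
open import Data.List using (List; []; _∷_; _++_; length; filter; map; upTo; foldr; replicate)
open import Data.List.Properties using (≡-dec)
open import Data.List.Relation.Unary.All using (All)
open import Data.List.Relation.Unary.Linked using (Linked)
open import Data.List.Relation.Unary.Unique.Propositional using (Unique)
open import Data.List.Membership.Propositional using (_∈_; _∉_)
open import Data.Product using (_×_; _,_; Σ)
open import Function.Bundles using (_⇔_)
open import Relation.Binary.PropositionalEquality using (_≡_; refl)
open import Relation.Nullary using (Dec; yes; no)

IsPartition : List ℕ → Set
IsPartition λs = Linked (λ a b → b ≤ a) λs × All (λ a → 0 < a) λs

countGe : ℕ → List ℕ → ℕ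
countGe j xs = length (filter (j ≤?_) xs)

-- hook lengths of the cells (i,1),…,(i,r) of a row of length r, given
-- the rows strictly below it: h_{i,j} = #{(i,b) : b ≥ j} + #{(a,j) : a > i}
--                                   = (r ∸ j + 1) + #{a > i : λ_a ≥ j}.
rowHooks : ℕ → List ℕ → List ℕ
rowHooks r below = map (λ j → suc (r ∸ j) Data.Nat.+ countGe j below) (map suc (upTo r))

hooks : List ℕ → List ℕ
hooks [] = []
hooks (r ∷ rs) = rowHooks r rs ++ hooks rs

IsCore : ℕ → List ℕ → Set
IsCore p λs = p ∉ hooks λs

data Letter : Set where
  X Y : Letter

Word : Set
Word = List Letter

_≟L_ : (a b : Letter) → Dec (a ≡ b)
X ≟L X = yes refl
X ≟L Y = no (λ ())
Y ≟L X = no (λ ())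
Y ≟L Y = yes refl

_≟W_ : (u v : Word) → Dec (u ≡ v)
_≟W_ = ≡-dec _≟L_

headOr0 : List ℕ → ℕ
headOr0 [] = 0
headOr0 (x ∷ _) = x

-- partition sequence M(λ) = Y^{λ_ℓ} X Y^{λ_{ℓ-1}-λ_ℓ} X ⋯ Y^{λ₁-λ₂} X
M : List ℕ → Word
M [] = []
M (r ∷ rs) = M rs ++ (replicate (r ∸ headOr0 rs) Y ++ (X ∷ []))

Series : Set
Series = Word → ℤ

sumℤ : List ℤ → ℤ
sumℤ = foldr _+_ (+ 0)

mono : Word → Series
mono u w with u ≟W w
... | yes _ = + 1
... | no _ = + 0

one : Series
one = mono []

_⊕_ : Series → Series → Series
(f ⊕ g) w = f w + g w

_⊖_ : Series → Series → Series
(f ⊖ g) w = f w - g w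

splits : Word → List (Word × Word)
splits [] = ([] , []) ∷ []
splits (a ∷ w) = ([] , a ∷ w) ∷ map (λ { (u , v) → (a ∷ u , v) }) (splits w)

_⊛_ : Series → Series → Series
(f ⊛ g) w = sumℤ (map (λ { (u , v) → f u * g v }) (splits w))

infixl 7 _⊛_
infixl 6 _⊕_ _⊖_

pow : Series → ℕ → Series
pow f zero = one
pow f (suc k) = f ⊛ pow f k

-- 1/(1-f) = Σ_{k≥0} f^k, for f without constant term.  The coefficient of a
-- word w only receives contributions from k ≤ |w| (f^k has no terms of
-- length < k), so the sum is taken over k = 0,…,|w|.
geom : Series → Series
geom f w = sumℤ (map (λ k → pow f k w) (upTo (suc (length w))))

-- "Σ_{λ ∈ C_(p)} M(λ) = F": for every word w, the coefficient F w equals the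
-- number of p-core partitions λ with M(λ) = w, witnessed by a duplicate-free
-- list enumerating exactly those partitions.

CoreSumEquals : ℕ → Series → Set
CoreSumEquals p F =
  (w : Word) → Σ (List (List ℕ)) λ L →
    Unique L ×
    ((λs : List ℕ) → (λs ∈ L) ⇔ (IsPartition λs × IsCore p λs × M λs ≡ w)) ×
    F w ≡ + length L

{-# OPTIONS --safe #-}
module Submission where

-- A cell of λ with hook length h corresponds to a Y of M(λ), the step closing its column,
-- followed exactly h letters later by an X, the step closing its row. So λ is a p-core iff
-- no X of M(λ) has a Y exactly p letters before it; as M is injective on partitions, with
-- image the empty word and the words Y u X, the partition sequences of p-cores form a regular
-- language, recognised by an automaton that remembers the last p letters read.
-- Each right-hand side is a rational series built from letters and stars (b u)*. Its iterated
-- left derivatives, written as normalised ℤ-combinations of products of such atoms, take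
-- finitely many values; the type checker computes them and checks that they form a
-- bisimulation with the automaton. Hence each coefficient is 1 on the partition sequences of
-- p-cores and 0 elsewhere.

open import Defs
open import Data.Bool using (Bool; true; false)
open import Data.Empty using (⊥-elim)
open import Data.List using (List; []; _∷_; _++_; length; map)
open import Data.Nat using (ℕ; zero; suc)
open import Data.Product using (_×_; _,_; proj₁; proj₂)
open import Function using (_∘_; case_of_)
open import Relation.Binary.Definitions using (DecidableEquality)
open import Relation.Binary.PropositionalEquality
open import Relation.Nullary using (¬_; Dec; yes; no; map′)

module SeriesAlgebra where

  open import Data.List using (applyUpTo)
  open import Data.List.Properties using (map-∘; map-upTo; ∷-injectiveˡ; ∷-injectiveʳ)
  open import Data.Nat using (_≤_; _<_; z≤n; s≤s) renaming (_+_ to _+ℕ_)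
  open import Data.Nat.Properties using (≤-refl; m≤n⇒m≤1+n; ≤-<-trans; m≤n⇒∃[o]m+o≡n)
  open import Data.Integer using (ℤ; 0ℤ; 1ℤ; _+_; _*_)
  open import Data.Integer.Properties using (*-zeroʳ; *-identityˡ; *-identityʳ; +-identityʳ; +-identityˡ)
  open import Data.Integer.Tactic.RingSolver using (solve-∀)

  infix 4 _≈_
  infixr 8 _·_

  _≈_ : Series → Series → Set
  f ≈ g = ∀ w → f w ≡ g w

  0ˢ : Series
  0ˢ _ = 0ℤ

  _·_ : ℤ → Series → Series
  (c · f) w = c * f w

  ∂ : Letter → Series → Series
  ∂ a f w = f (a ∷ w)

  -- The laws below follow from this product rule by induction on the word, without ever
  -- unfolding the sum over factorisations.
  ⊛-∷ : ∀ f g a w → (f ⊛ g) (a ∷ w) ≡ f [] * g (a ∷ w) + (∂ a f ⊛ g) w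
  ⊛-∷ f g a w = cong (f [] * g (a ∷ w) +_) (cong sumℤ (sym (map-∘ (splits w))))

  ⊛-cong : ∀ {f f′ g g′} → f ≈ f′ → g ≈ g′ → f ⊛ g ≈ f′ ⊛ g′
  ⊛-cong f≈ g≈ [] = cong₂ (λ x y → x * y + 0ℤ) (f≈ []) (g≈ [])
  ⊛-cong {f} {f′} {g} {g′} f≈ g≈ (a ∷ w) = begin
    (f ⊛ g) (a ∷ w)
      ≡⟨ ⊛-∷ f g a w ⟩
    f [] * g (a ∷ w) + (∂ a f ⊛ g) w
      ≡⟨ cong₂ _+_ (cong₂ _*_ (f≈ []) (g≈ (a ∷ w))) (⊛-cong (f≈ ∘ (a ∷_)) g≈ w) ⟩
    f′ [] * g′ (a ∷ w) + (∂ a f′ ⊛ g′) w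
      ≡⟨ ⊛-∷ f′ g′ a w ⟨
    (f′ ⊛ g′) (a ∷ w) ∎
    where open ≡-Reasoning

  ⊛-congˡ : ∀ {f f′} g → f ≈ f′ → f ⊛ g ≈ f′ ⊛ g
  ⊛-congˡ {f} {f′} g f≈ = ⊛-cong {f} {f′} {g} {g} f≈ (λ _ → refl)

  ⊛-congʳ : ∀ f {g g′} → g ≈ g′ → f ⊛ g ≈ f ⊛ g′
  ⊛-congʳ f {g} {g′} g≈ = ⊛-cong {f} {f} {g} {g′} (λ _ → refl) g≈

  ⊛-congʳ-≤ : ∀ f {g g′} w → (∀ v → length v ≤ length w → g v ≡ g′ v) → (f ⊛ g) w ≡ (f ⊛ g′) w
  ⊛-congʳ-≤ f [] g≈ = cong (λ x → f [] * x + 0ℤ) (g≈ [] z≤n)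
  ⊛-congʳ-≤ f {g} {g′} (a ∷ w) g≈ = begin
    (f ⊛ g) (a ∷ w)
      ≡⟨ ⊛-∷ f g a w ⟩
    f [] * g (a ∷ w) + (∂ a f ⊛ g) w
      ≡⟨ cong₂ _+_ (cong (f [] *_) (g≈ (a ∷ w) ≤-refl))
                   (⊛-congʳ-≤ (∂ a f) w (λ v → g≈ v ∘ m≤n⇒m≤1+n)) ⟩
    f [] * g′ (a ∷ w) + (∂ a f ⊛ g′) w
      ≡⟨ ⊛-∷ f g′ a w ⟨
    (f ⊛ g′) (a ∷ w) ∎
    where open ≡-Reasoning

  ⊛-distribʳ-⊕ : ∀ f g h → (f ⊕ g) ⊛ h ≈ f ⊛ h ⊕ g ⊛ h
  ⊛-distribʳ-⊕ f g h [] = distrib (f []) (g []) (h [])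
    where
    distrib : ∀ x y z → (x + y) * z + 0ℤ ≡ (x * z + 0ℤ) + (y * z + 0ℤ)
    distrib = solve-∀
  ⊛-distribʳ-⊕ f g h (a ∷ w) = begin
    ((f ⊕ g) ⊛ h) (a ∷ w)
      ≡⟨ ⊛-∷ (f ⊕ g) h a w ⟩
    (f [] + g []) * h (a ∷ w) + ((∂ a f ⊕ ∂ a g) ⊛ h) w
      ≡⟨ cong ((f [] + g []) * h (a ∷ w) +_) (⊛-distribʳ-⊕ (∂ a f) (∂ a g) h w) ⟩
    (f [] + g []) * h (a ∷ w) + ((∂ a f ⊛ h) w + (∂ a g ⊛ h) w)
      ≡⟨ regroup (f []) (g []) (h (a ∷ w)) _ _ ⟩
    (f [] * h (a ∷ w) + (∂ a f ⊛ h) w) + (g [] * h (a ∷ w) + (∂ a g ⊛ h) w)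
      ≡⟨ cong₂ _+_ (⊛-∷ f h a w) (⊛-∷ g h a w) ⟨
    (f ⊛ h ⊕ g ⊛ h) (a ∷ w) ∎
    where
    open ≡-Reasoning
    regroup : ∀ x y z s t → (x + y) * z + (s + t) ≡ (x * z + s) + (y * z + t)
    regroup = solve-∀

  ⊛-distribˡ-⊕ : ∀ f g h → f ⊛ (g ⊕ h) ≈ f ⊛ g ⊕ f ⊛ h
  ⊛-distribˡ-⊕ f g h [] = distrib (f []) (g []) (h [])
    where
    distrib : ∀ x y z → x * (y + z) + 0ℤ ≡ (x * y + 0ℤ) + (x * z + 0ℤ)
    distrib = solve-∀
  ⊛-distribˡ-⊕ f g h (a ∷ w) = begin
    (f ⊛ (g ⊕ h)) (a ∷ w)
      ≡⟨ ⊛-∷ f (g ⊕ h) a w ⟩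
    f [] * (g (a ∷ w) + h (a ∷ w)) + (∂ a f ⊛ (g ⊕ h)) w
      ≡⟨ cong (f [] * (g (a ∷ w) + h (a ∷ w)) +_) (⊛-distribˡ-⊕ (∂ a f) g h w) ⟩
    f [] * (g (a ∷ w) + h (a ∷ w)) + ((∂ a f ⊛ g) w + (∂ a f ⊛ h) w)
      ≡⟨ regroup (f []) (g (a ∷ w)) (h (a ∷ w)) _ _ ⟩
    (f [] * g (a ∷ w) + (∂ a f ⊛ g) w) + (f [] * h (a ∷ w) + (∂ a f ⊛ h) w)
      ≡⟨ cong₂ _+_ (⊛-∷ f g a w) (⊛-∷ f h a w) ⟨
    (f ⊛ g ⊕ f ⊛ h) (a ∷ w) ∎
    where
    open ≡-Reasoning
    regroup : ∀ x y z s t → x * (y + z) + (s + t) ≡ (x * y + s) + (x * z + t)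
    regroup = solve-∀

  ·-⊛-assoc : ∀ c f g → (c · f) ⊛ g ≈ c · (f ⊛ g)
  ·-⊛-assoc c f g [] = assoc c (f []) (g [])
    where
    assoc : ∀ c x y → c * x * y + 0ℤ ≡ c * (x * y + 0ℤ)
    assoc = solve-∀
  ·-⊛-assoc c f g (a ∷ w) = begin
    ((c · f) ⊛ g) (a ∷ w)
      ≡⟨ ⊛-∷ (c · f) g a w ⟩
    c * f [] * g (a ∷ w) + ((c · ∂ a f) ⊛ g) w
      ≡⟨ cong (c * f [] * g (a ∷ w) +_) (·-⊛-assoc c (∂ a f) g w) ⟩
    c * f [] * g (a ∷ w) + c * (∂ a f ⊛ g) w
      ≡⟨ factor c (f []) (g (a ∷ w)) _ ⟩
    c * (f [] * g (a ∷ w) + (∂ a f ⊛ g) w)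
      ≡⟨ cong (c *_) (⊛-∷ f g a w) ⟨
    (c · (f ⊛ g)) (a ∷ w) ∎
    where
    open ≡-Reasoning
    factor : ∀ c x y s → c * x * y + c * s ≡ c * (x * y + s)
    factor = solve-∀

  ⊛-·-comm : ∀ c f g → f ⊛ (c · g) ≈ c · (f ⊛ g)
  ⊛-·-comm c f g [] = assoc c (f []) (g [])
    where
    assoc : ∀ c x y → x * (c * y) + 0ℤ ≡ c * (x * y + 0ℤ)
    assoc = solve-∀
  ⊛-·-comm c f g (a ∷ w) = begin
    (f ⊛ (c · g)) (a ∷ w)
      ≡⟨ ⊛-∷ f (c · g) a w ⟩
    f [] * (c * g (a ∷ w)) + (∂ a f ⊛ (c · g)) w
      ≡⟨ cong (f [] * (c * g (a ∷ w)) +_) (⊛-·-comm c (∂ a f) g w) ⟩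
    f [] * (c * g (a ∷ w)) + c * (∂ a f ⊛ g) w
      ≡⟨ factor c (f []) (g (a ∷ w)) _ ⟩
    c * (f [] * g (a ∷ w) + (∂ a f ⊛ g) w)
      ≡⟨ cong (c *_) (⊛-∷ f g a w) ⟨
    (c · (f ⊛ g)) (a ∷ w) ∎
    where
    open ≡-Reasoning
    factor : ∀ c x y s → x * (c * y) + c * s ≡ c * (x * y + s)
    factor = solve-∀

  ⊛-zeroˡ : ∀ g → 0ˢ ⊛ g ≈ 0ˢ
  ⊛-zeroˡ g [] = refl
  ⊛-zeroˡ g (a ∷ w) = trans (⊛-∷ 0ˢ g a w) (trans (+-identityˡ _) (⊛-zeroˡ g w))

  ⊛-zeroʳ : ∀ f → f ⊛ 0ˢ ≈ 0ˢ
  ⊛-zeroʳ f [] = cong (_+ 0ℤ) (*-zeroʳ (f []))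
  ⊛-zeroʳ f (a ∷ w) = trans (⊛-∷ f 0ˢ a w) (cong₂ _+_ (*-zeroʳ (f [])) (⊛-zeroʳ (∂ a f) w))

  ⊛-identityˡ : ∀ f → one ⊛ f ≈ f
  ⊛-identityˡ f [] = trans (+-identityʳ _) (*-identityˡ (f []))
  ⊛-identityˡ f (a ∷ w) = begin
    (one ⊛ f) (a ∷ w)
      ≡⟨ ⊛-∷ one f a w ⟩
    1ℤ * f (a ∷ w) + (∂ a one ⊛ f) w
      ≡⟨ cong₂ _+_ (*-identityˡ (f (a ∷ w))) (⊛-zeroˡ f w) ⟩
    f (a ∷ w) + 0ℤ
      ≡⟨ +-identityʳ _ ⟩
    f (a ∷ w) ∎
    where open ≡-Reasoning

  ⊛-identityʳ : ∀ f → f ⊛ one ≈ f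
  ⊛-identityʳ f [] = trans (+-identityʳ _) (*-identityʳ (f []))
  ⊛-identityʳ f (a ∷ w) = begin
    (f ⊛ one) (a ∷ w)
      ≡⟨ ⊛-∷ f one a w ⟩
    f [] * 0ℤ + (∂ a f ⊛ one) w
      ≡⟨ cong₂ _+_ (*-zeroʳ (f [])) (⊛-identityʳ (∂ a f) w) ⟩
    0ℤ + f (a ∷ w)
      ≡⟨ +-identityˡ _ ⟩
    f (a ∷ w) ∎
    where open ≡-Reasoning

  ⊛-assoc : ∀ f g h → (f ⊛ g) ⊛ h ≈ f ⊛ (g ⊛ h)
  ⊛-assoc f g h [] = assoc (f []) (g []) (h [])
    where
    assoc : ∀ x y z → (x * y + 0ℤ) * z + 0ℤ ≡ x * (y * z + 0ℤ) + 0ℤ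
    assoc = solve-∀
  ⊛-assoc f g h (a ∷ w) = begin
    ((f ⊛ g) ⊛ h) (a ∷ w)
      ≡⟨ ⊛-∷ (f ⊛ g) h a w ⟩
    (f ⊛ g) [] * h (a ∷ w) + (∂ a (f ⊛ g) ⊛ h) w
      ≡⟨ cong ((f ⊛ g) [] * h (a ∷ w) +_) ∂fg⊛h ⟩
    (f ⊛ g) [] * h (a ∷ w) + (f [] * (∂ a g ⊛ h) w + (∂ a f ⊛ (g ⊛ h)) w)
      ≡⟨ regroup (f []) (g []) (h (a ∷ w)) _ _ ⟩
    f [] * (g [] * h (a ∷ w) + (∂ a g ⊛ h) w) + (∂ a f ⊛ (g ⊛ h)) w
      ≡⟨ cong (λ x → f [] * x + (∂ a f ⊛ (g ⊛ h)) w) (⊛-∷ g h a w) ⟨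
    f [] * (g ⊛ h) (a ∷ w) + (∂ a f ⊛ (g ⊛ h)) w
      ≡⟨ ⊛-∷ f (g ⊛ h) a w ⟨
    (f ⊛ (g ⊛ h)) (a ∷ w) ∎
    where
    open ≡-Reasoning
    ∂fg⊛h : (∂ a (f ⊛ g) ⊛ h) w ≡ f [] * (∂ a g ⊛ h) w + (∂ a f ⊛ (g ⊛ h)) w
    ∂fg⊛h = begin
      (∂ a (f ⊛ g) ⊛ h) w
        ≡⟨ ⊛-congˡ h (⊛-∷ f g a) w ⟩
      ((f [] · ∂ a g ⊕ ∂ a f ⊛ g) ⊛ h) w
        ≡⟨ ⊛-distribʳ-⊕ (f [] · ∂ a g) (∂ a f ⊛ g) h w ⟩
      ((f [] · ∂ a g) ⊛ h) w + ((∂ a f ⊛ g) ⊛ h) w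
        ≡⟨ cong₂ _+_ (·-⊛-assoc (f []) (∂ a g) h w) (⊛-assoc (∂ a f) g h w) ⟩
      f [] * (∂ a g ⊛ h) w + (∂ a f ⊛ (g ⊛ h)) w ∎
    regroup : ∀ x y z t s → (x * y + 0ℤ) * z + (x * t + s) ≡ x * (y * z + t) + s
    regroup = solve-∀

  mono-refl : ∀ u → mono u u ≡ 1ℤ
  mono-refl u with u ≟W u
  ... | yes _ = refl
  ... | no u≢u = ⊥-elim (u≢u refl)

  mono-≢ : ∀ {u w} → u ≢ w → mono u w ≡ 0ℤ
  mono-≢ {u} {w} u≢w with u ≟W w
  ... | yes u≡w = ⊥-elim (u≢w u≡w)
  ... | no _ = refl

  ∂-mono-∷ : ∀ b u → ∂ b (mono (b ∷ u)) ≈ mono u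
  ∂-mono-∷ b u w = case u ≟W w of λ where
    (yes refl) → trans (mono-refl (b ∷ u)) (sym (mono-refl u))
    (no u≢w)   → trans (mono-≢ (u≢w ∘ ∷-injectiveʳ)) (sym (mono-≢ u≢w))

  ∂-mono-∷-≢ : ∀ {a b} u → a ≢ b → ∂ a (mono (b ∷ u)) ≈ 0ˢ
  ∂-mono-∷-≢ u a≢b w = mono-≢ (a≢b ∘ sym ∘ ∷-injectiveˡ)

  mono-∷ : ∀ b u → mono (b ∷ u) ≈ mono (b ∷ []) ⊛ mono u
  mono-∷ b u []      = refl
  mono-∷ b u (a ∷ w) = begin
    mono (b ∷ u) (a ∷ w)
      ≡⟨ derivatives-agree ⟩
    (∂ a (mono (b ∷ [])) ⊛ mono u) w
      ≡⟨ +-identityˡ _ ⟨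
    0ℤ + (∂ a (mono (b ∷ [])) ⊛ mono u) w
      ≡⟨ ⊛-∷ (mono (b ∷ [])) (mono u) a w ⟨
    (mono (b ∷ []) ⊛ mono u) (a ∷ w) ∎
    where
    open ≡-Reasoning
    derivatives-agree : mono (b ∷ u) (a ∷ w) ≡ (∂ a (mono (b ∷ [])) ⊛ mono u) w
    derivatives-agree = case a ≟L b of λ where
      (yes refl) → trans (∂-mono-∷ a u w)
                         (sym (trans (⊛-congˡ (mono u) (∂-mono-∷ a []) w) (⊛-identityˡ (mono u) w)))
      (no a≢b)   → trans (∂-mono-∷-≢ u a≢b w)
                         (sym (trans (⊛-congˡ (mono u) (∂-mono-∷-≢ [] a≢b) w) (⊛-zeroˡ (mono u) w)))

  Σˢ : (ℕ → Series) → ℕ → Series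
  Σˢ F n w = sumℤ (applyUpTo (λ k → F k w) n)

  Σˢ-cong : ∀ F G n v w → (∀ k → F k v ≡ G k w) → Σˢ F n v ≡ Σˢ G n w
  Σˢ-cong F G zero    v w F≡G = refl
  Σˢ-cong F G (suc n) v w F≡G = cong₂ _+_ (F≡G 0) (Σˢ-cong (F ∘ suc) (G ∘ suc) n v w (F≡G ∘ suc))

  ⊛-distribˡ-Σˢ : ∀ f F n → f ⊛ Σˢ F n ≈ Σˢ (λ k → f ⊛ F k) n
  ⊛-distribˡ-Σˢ f F zero    w = ⊛-zeroʳ f w
  ⊛-distribˡ-Σˢ f F (suc n) w =
    trans (⊛-distribˡ-⊕ f (F 0) (Σˢ (F ∘ suc) n) w)
          (cong ((f ⊛ F 0) w +_) (⊛-distribˡ-Σˢ f (F ∘ suc) n w))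

  Σˢ-vanishing : ∀ F n d w → (∀ k → n ≤ k → F k w ≡ 0ℤ) → Σˢ F (n +ℕ d) w ≡ Σˢ F n w
  Σˢ-vanishing F zero    zero    w _    = refl
  Σˢ-vanishing F zero    (suc d) w F≡0 =
    cong₂ _+_ (F≡0 0 z≤n) (Σˢ-vanishing (F ∘ suc) 0 d w (λ k _ → F≡0 (suc k) z≤n))
  Σˢ-vanishing F (suc n) d       w F≡0 =
    cong (F 0 w +_) (Σˢ-vanishing (F ∘ suc) n d w (λ k → F≡0 (suc k) ∘ s≤s))

  geom-Σˢ : ∀ f w → geom f w ≡ Σˢ (pow f) (suc (length w)) w
  geom-Σˢ f w = cong sumℤ (map-upTo (λ k → pow f k w) (suc (length w)))

  module _ (f : Series) (f[]≡0 : f [] ≡ 0ℤ) where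

    pow-suc-∷ : ∀ k a w → pow f (suc k) (a ∷ w) ≡ (∂ a f ⊛ pow f k) w
    pow-suc-∷ k a w = begin
      (f ⊛ pow f k) (a ∷ w)
        ≡⟨ ⊛-∷ f (pow f k) a w ⟩
      f [] * pow f k (a ∷ w) + (∂ a f ⊛ pow f k) w
        ≡⟨ cong (λ x → x * pow f k (a ∷ w) + (∂ a f ⊛ pow f k) w) f[]≡0 ⟩
      0ℤ + (∂ a f ⊛ pow f k) w
        ≡⟨ +-identityˡ _ ⟩
      (∂ a f ⊛ pow f k) w ∎
      where open ≡-Reasoning

    pow-vanishing : ∀ k w → length w < k → pow f k w ≡ 0ℤ
    pow-vanishing (suc k) []      _          rewrite f[]≡0 = refl
    pow-vanishing (suc k) (a ∷ w) (s≤s |w|<k) = begin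
      pow f (suc k) (a ∷ w)
        ≡⟨ pow-suc-∷ k a w ⟩
      (∂ a f ⊛ pow f k) w
        ≡⟨ ⊛-congʳ-≤ (∂ a f) w (λ v |v|≤|w| → pow-vanishing k v (≤-<-trans |v|≤|w| |w|<k)) ⟩
      (∂ a f ⊛ 0ˢ) w
        ≡⟨ ⊛-zeroʳ (∂ a f) w ⟩
      0ℤ ∎
      where open ≡-Reasoning

    geom-truncation : ∀ n w → length w ≤ n → Σˢ (pow f) (suc n) w ≡ geom f w
    geom-truncation n w |w|≤n with m≤n⇒∃[o]m+o≡n |w|≤n
    ... | d , refl = trans (Σˢ-vanishing (pow f) (suc (length w)) d w (λ k → pow-vanishing k w))
                           (sym (geom-Σˢ f w))

    ∂-geom : ∀ a → ∂ a (geom f) ≈ ∂ a f ⊛ geom f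
    ∂-geom a w = begin
      geom f (a ∷ w)
        ≡⟨ geom-Σˢ f (a ∷ w) ⟩
      0ℤ + Σˢ (pow f ∘ suc) (suc n) (a ∷ w)
        ≡⟨ +-identityˡ _ ⟩
      Σˢ (pow f ∘ suc) (suc n) (a ∷ w)
        ≡⟨ Σˢ-cong (pow f ∘ suc) (λ k → ∂ a f ⊛ pow f k) (suc n) (a ∷ w) w (λ k → pow-suc-∷ k a w) ⟩
      Σˢ (λ k → ∂ a f ⊛ pow f k) (suc n) w
        ≡⟨ ⊛-distribˡ-Σˢ (∂ a f) (pow f) (suc n) w ⟨
      (∂ a f ⊛ Σˢ (pow f) (suc n)) w
        ≡⟨ ⊛-congʳ-≤ (∂ a f) w (λ v → geom-truncation n v) ⟩
      (∂ a f ⊛ geom f) w ∎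
      where
      open ≡-Reasoning
      n = length w

module RationalExpressions where

  open SeriesAlgebra
  open import Data.List using (filter)
  open import Relation.Nullary using (¬?; _×-dec_)
  open import Data.Integer using (ℤ; 0ℤ; 1ℤ; -1ℤ; _+_; _*_; _-_; _≟_)
  open import Data.Integer.Properties
    using (*-zeroʳ; *-identityˡ; +-identityʳ; +-identityˡ; +-assoc; +-comm; *-assoc; *-distribˡ-+)
  open import Data.Integer.Tactic.RingSolver using (solve-∀)
  import Data.List.Properties as List
  import Data.Product.Properties as Product

  data Atom : Set where
    letter : Letter → Atom
    star   : Letter → Word → Atom

  Monomial : Set
  Monomial = List Atom

  Poly : Set
  Poly = List (ℤ × Monomial)

  ⟦_⟧ᵃ : Atom → Series
  ⟦ letter b ⟧ᵃ = mono (b ∷ [])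
  ⟦ star b u ⟧ᵃ = geom (mono (b ∷ u))

  ⟦_⟧ᵐ : Monomial → Series
  ⟦ [] ⟧ᵐ    = one
  ⟦ x ∷ m ⟧ᵐ = ⟦ x ⟧ᵃ ⊛ ⟦ m ⟧ᵐ

  ⟦_⟧ᵖ : Poly → Series
  ⟦ [] ⟧ᵖ          = 0ˢ
  ⟦ (c , m) ∷ p ⟧ᵖ = c · ⟦ m ⟧ᵐ ⊕ ⟦ p ⟧ᵖ

  monomial : Monomial → Poly
  monomial m = (1ℤ , m) ∷ []

  ⟦monomial⟧ : ∀ m → ⟦ monomial m ⟧ᵖ ≈ ⟦ m ⟧ᵐ
  ⟦monomial⟧ m w = trans (+-identityʳ _) (*-identityˡ _)

  ⟦word⟧ : ∀ u → ⟦ map letter u ⟧ᵐ ≈ mono u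
  ⟦word⟧ []      w = refl
  ⟦word⟧ (b ∷ u) w = sym (trans (mono-∷ b u w) (⊛-congʳ (mono (b ∷ [])) (λ v → sym (⟦word⟧ u v)) w))

  ⟦++⟧ᵐ : ∀ m m′ → ⟦ m ++ m′ ⟧ᵐ ≈ ⟦ m ⟧ᵐ ⊛ ⟦ m′ ⟧ᵐ
  ⟦++⟧ᵐ []      m′ w = sym (⊛-identityˡ ⟦ m′ ⟧ᵐ w)
  ⟦++⟧ᵐ (x ∷ m) m′ w =
    trans (⊛-congʳ ⟦ x ⟧ᵃ (⟦++⟧ᵐ m m′) w) (sym (⊛-assoc ⟦ x ⟧ᵃ ⟦ m ⟧ᵐ ⟦ m′ ⟧ᵐ w))

  ⟦++⟧ᵖ : ∀ p p′ → ⟦ p ++ p′ ⟧ᵖ ≈ ⟦ p ⟧ᵖ ⊕ ⟦ p′ ⟧ᵖ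
  ⟦++⟧ᵖ []            p′ w = sym (+-identityˡ _)
  ⟦++⟧ᵖ ((c , m) ∷ p) p′ w =
    trans (cong (c * ⟦ m ⟧ᵐ w +_) (⟦++⟧ᵖ p p′ w)) (sym (+-assoc (c * ⟦ m ⟧ᵐ w) (⟦ p ⟧ᵖ w) (⟦ p′ ⟧ᵖ w)))

  scale : ℤ → Poly → Poly
  scale c = map λ (d , m) → (c * d , m)

  ⟦scale⟧ : ∀ c p → ⟦ scale c p ⟧ᵖ ≈ c · ⟦ p ⟧ᵖ
  ⟦scale⟧ c []            w = sym (*-zeroʳ c)
  ⟦scale⟧ c ((d , m) ∷ p) w =
    trans (cong₂ _+_ (*-assoc c d _) (⟦scale⟧ c p w)) (sym (*-distribˡ-+ c _ _))

  infixl 7 _⊛ᵐ_ _ᵐ⊛_ _⊛ᵖ_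

  _⊛ᵐ_ : Poly → Monomial → Poly
  p ⊛ᵐ m = map (λ (d , m′) → (d , m′ ++ m)) p

  ⟦⊛ᵐ⟧ : ∀ p m → ⟦ p ⊛ᵐ m ⟧ᵖ ≈ ⟦ p ⟧ᵖ ⊛ ⟦ m ⟧ᵐ
  ⟦⊛ᵐ⟧ []             m w = sym (⊛-zeroˡ ⟦ m ⟧ᵐ w)
  ⟦⊛ᵐ⟧ ((d , m′) ∷ p) m w = begin
    ⟦ ((d , m′) ∷ p) ⊛ᵐ m ⟧ᵖ w
      ≡⟨ cong₂ (λ x y → d * x + y) (⟦++⟧ᵐ m′ m w) (⟦⊛ᵐ⟧ p m w) ⟩
    d * (⟦ m′ ⟧ᵐ ⊛ ⟦ m ⟧ᵐ) w + (⟦ p ⟧ᵖ ⊛ ⟦ m ⟧ᵐ) w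
      ≡⟨ cong (_+ (⟦ p ⟧ᵖ ⊛ ⟦ m ⟧ᵐ) w) (·-⊛-assoc d ⟦ m′ ⟧ᵐ ⟦ m ⟧ᵐ w) ⟨
    ((d · ⟦ m′ ⟧ᵐ) ⊛ ⟦ m ⟧ᵐ) w + (⟦ p ⟧ᵖ ⊛ ⟦ m ⟧ᵐ) w
      ≡⟨ ⊛-distribʳ-⊕ (d · ⟦ m′ ⟧ᵐ) ⟦ p ⟧ᵖ ⟦ m ⟧ᵐ w ⟨
    ((d · ⟦ m′ ⟧ᵐ ⊕ ⟦ p ⟧ᵖ) ⊛ ⟦ m ⟧ᵐ) w ∎
    where open ≡-Reasoning

  _ᵐ⊛_ : Monomial → Poly → Poly
  m ᵐ⊛ p = map (λ (d , m′) → (d , m ++ m′)) p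

  ⟦ᵐ⊛⟧ : ∀ m p → ⟦ m ᵐ⊛ p ⟧ᵖ ≈ ⟦ m ⟧ᵐ ⊛ ⟦ p ⟧ᵖ
  ⟦ᵐ⊛⟧ m []             w = sym (⊛-zeroʳ ⟦ m ⟧ᵐ w)
  ⟦ᵐ⊛⟧ m ((d , m′) ∷ p) w = begin
    ⟦ m ᵐ⊛ ((d , m′) ∷ p) ⟧ᵖ w
      ≡⟨ cong₂ (λ x y → d * x + y) (⟦++⟧ᵐ m m′ w) (⟦ᵐ⊛⟧ m p w) ⟩
    d * (⟦ m ⟧ᵐ ⊛ ⟦ m′ ⟧ᵐ) w + (⟦ m ⟧ᵐ ⊛ ⟦ p ⟧ᵖ) w
      ≡⟨ cong (_+ (⟦ m ⟧ᵐ ⊛ ⟦ p ⟧ᵖ) w) (⊛-·-comm d ⟦ m ⟧ᵐ ⟦ m′ ⟧ᵐ w) ⟨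
    (⟦ m ⟧ᵐ ⊛ (d · ⟦ m′ ⟧ᵐ)) w + (⟦ m ⟧ᵐ ⊛ ⟦ p ⟧ᵖ) w
      ≡⟨ ⊛-distribˡ-⊕ ⟦ m ⟧ᵐ (d · ⟦ m′ ⟧ᵐ) ⟦ p ⟧ᵖ w ⟨
    (⟦ m ⟧ᵐ ⊛ (d · ⟦ m′ ⟧ᵐ ⊕ ⟦ p ⟧ᵖ)) w ∎
    where open ≡-Reasoning

  _⊛ᵖ_ : Poly → Poly → Poly
  []            ⊛ᵖ q = []
  ((c , m) ∷ p) ⊛ᵖ q = scale c (m ᵐ⊛ q) ++ p ⊛ᵖ q

  ⟦⊛ᵖ⟧ : ∀ p q → ⟦ p ⊛ᵖ q ⟧ᵖ ≈ ⟦ p ⟧ᵖ ⊛ ⟦ q ⟧ᵖ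
  ⟦⊛ᵖ⟧ []            q w = sym (⊛-zeroˡ ⟦ q ⟧ᵖ w)
  ⟦⊛ᵖ⟧ ((c , m) ∷ p) q w = begin
    ⟦ scale c (m ᵐ⊛ q) ++ p ⊛ᵖ q ⟧ᵖ w
      ≡⟨ ⟦++⟧ᵖ (scale c (m ᵐ⊛ q)) (p ⊛ᵖ q) w ⟩
    ⟦ scale c (m ᵐ⊛ q) ⟧ᵖ w + ⟦ p ⊛ᵖ q ⟧ᵖ w
      ≡⟨ cong₂ _+_ (trans (⟦scale⟧ c (m ᵐ⊛ q) w) (cong (c *_) (⟦ᵐ⊛⟧ m q w))) (⟦⊛ᵖ⟧ p q w) ⟩
    c * (⟦ m ⟧ᵐ ⊛ ⟦ q ⟧ᵖ) w + (⟦ p ⟧ᵖ ⊛ ⟦ q ⟧ᵖ) w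
      ≡⟨ cong (_+ (⟦ p ⟧ᵖ ⊛ ⟦ q ⟧ᵖ) w) (·-⊛-assoc c ⟦ m ⟧ᵐ ⟦ q ⟧ᵖ w) ⟨
    ((c · ⟦ m ⟧ᵐ) ⊛ ⟦ q ⟧ᵖ) w + (⟦ p ⟧ᵖ ⊛ ⟦ q ⟧ᵖ) w
      ≡⟨ ⊛-distribʳ-⊕ (c · ⟦ m ⟧ᵐ) ⟦ p ⟧ᵖ ⟦ q ⟧ᵖ w ⟨
    ((c · ⟦ m ⟧ᵐ ⊕ ⟦ p ⟧ᵖ) ⊛ ⟦ q ⟧ᵖ) w ∎
    where open ≡-Reasoning

  νᵃ : Atom → ℤ
  νᵃ (letter _) = 0ℤ
  νᵃ (star _ _) = 1ℤ

  νᵐ : Monomial → ℤ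
  νᵐ []      = 1ℤ
  νᵐ (x ∷ m) = νᵃ x * νᵐ m

  νᵖ : Poly → ℤ
  νᵖ []            = 0ℤ
  νᵖ ((c , m) ∷ p) = c * νᵐ m + νᵖ p

  ⟦⟧ᵃ-[] : ∀ x → ⟦ x ⟧ᵃ [] ≡ νᵃ x
  ⟦⟧ᵃ-[] (letter _) = refl
  ⟦⟧ᵃ-[] (star _ _) = refl

  ⟦⟧ᵐ-[] : ∀ m → ⟦ m ⟧ᵐ [] ≡ νᵐ m
  ⟦⟧ᵐ-[] []      = refl
  ⟦⟧ᵐ-[] (x ∷ m) = trans (+-identityʳ _) (cong₂ _*_ (⟦⟧ᵃ-[] x) (⟦⟧ᵐ-[] m))

  ⟦⟧ᵖ-[] : ∀ p → ⟦ p ⟧ᵖ [] ≡ νᵖ p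
  ⟦⟧ᵖ-[] []            = refl
  ⟦⟧ᵖ-[] ((c , m) ∷ p) = cong₂ _+_ (cong (c *_) (⟦⟧ᵐ-[] m)) (⟦⟧ᵖ-[] p)

  ∂ᵃ : Letter → Atom → Poly
  ∂ᵃ a (letter b) with a ≟L b
  ... | yes _ = monomial []
  ... | no  _ = []
  ∂ᵃ a (star b u) with a ≟L b
  ... | yes _ = monomial (map letter u ++ star b u ∷ [])
  ... | no  _ = []

  ∂-⟦⟧ᵃ : ∀ a x → ∂ a ⟦ x ⟧ᵃ ≈ ⟦ ∂ᵃ a x ⟧ᵖ
  ∂-⟦⟧ᵃ a (letter b) w with a ≟L b
  ... | yes refl = trans (∂-mono-∷ a [] w) (sym (⟦monomial⟧ [] w))
  ... | no  a≢b  = ∂-mono-∷-≢ [] a≢b w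
  ∂-⟦⟧ᵃ a (star b u) w with a ≟L b
  ... | no  a≢b  =
    trans (∂-geom G refl a w) (trans (⊛-congˡ (geom G) (∂-mono-∷-≢ u a≢b) w) (⊛-zeroˡ (geom G) w))
    where G = mono (b ∷ u)
  ... | yes refl = begin
    ∂ a (geom G) w
      ≡⟨ ∂-geom G refl a w ⟩
    (∂ a G ⊛ geom G) w
      ≡⟨ ⊛-cong (λ v → trans (∂-mono-∷ a u v) (sym (⟦word⟧ u v)))
                (λ v → sym (⊛-identityʳ (geom G) v)) w ⟩
    (⟦ map letter u ⟧ᵐ ⊛ ⟦ star a u ∷ [] ⟧ᵐ) w
      ≡⟨ ⟦++⟧ᵐ (map letter u) (star a u ∷ []) w ⟨
    ⟦ map letter u ++ star a u ∷ [] ⟧ᵐ w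
      ≡⟨ ⟦monomial⟧ (map letter u ++ star a u ∷ []) w ⟨
    ⟦ monomial (map letter u ++ star a u ∷ []) ⟧ᵖ w ∎
    where
    open ≡-Reasoning
    G = mono (a ∷ u)

  ∂ᵐ : Letter → Monomial → Poly
  ∂ᵐ a []      = []
  ∂ᵐ a (x ∷ m) = ∂ᵃ a x ⊛ᵐ m ++ scale (νᵃ x) (∂ᵐ a m)

  ∂-⟦⟧ᵐ : ∀ a m → ∂ a ⟦ m ⟧ᵐ ≈ ⟦ ∂ᵐ a m ⟧ᵖ
  ∂-⟦⟧ᵐ a []      w = refl
  ∂-⟦⟧ᵐ a (x ∷ m) w = begin
    (⟦ x ⟧ᵃ ⊛ ⟦ m ⟧ᵐ) (a ∷ w)
      ≡⟨ ⊛-∷ ⟦ x ⟧ᵃ ⟦ m ⟧ᵐ a w ⟩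
    ⟦ x ⟧ᵃ [] * ⟦ m ⟧ᵐ (a ∷ w) + (∂ a ⟦ x ⟧ᵃ ⊛ ⟦ m ⟧ᵐ) w
      ≡⟨ cong₂ _+_ (cong₂ _*_ (⟦⟧ᵃ-[] x) (∂-⟦⟧ᵐ a m w)) (⊛-congˡ ⟦ m ⟧ᵐ (∂-⟦⟧ᵃ a x) w) ⟩
    νᵃ x * ⟦ ∂ᵐ a m ⟧ᵖ w + (⟦ ∂ᵃ a x ⟧ᵖ ⊛ ⟦ m ⟧ᵐ) w
      ≡⟨ +-comm (νᵃ x * ⟦ ∂ᵐ a m ⟧ᵖ w) _ ⟩
    (⟦ ∂ᵃ a x ⟧ᵖ ⊛ ⟦ m ⟧ᵐ) w + νᵃ x * ⟦ ∂ᵐ a m ⟧ᵖ w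
      ≡⟨ cong₂ _+_ (⟦⊛ᵐ⟧ (∂ᵃ a x) m w) (⟦scale⟧ (νᵃ x) (∂ᵐ a m) w) ⟨
    ⟦ ∂ᵃ a x ⊛ᵐ m ⟧ᵖ w + ⟦ scale (νᵃ x) (∂ᵐ a m) ⟧ᵖ w
      ≡⟨ ⟦++⟧ᵖ (∂ᵃ a x ⊛ᵐ m) (scale (νᵃ x) (∂ᵐ a m)) w ⟨
    ⟦ ∂ᵐ a (x ∷ m) ⟧ᵖ w ∎
    where open ≡-Reasoning

  ∂ᵖ : Letter → Poly → Poly
  ∂ᵖ a []            = []
  ∂ᵖ a ((c , m) ∷ p) = scale c (∂ᵐ a m) ++ ∂ᵖ a p

  ∂-⟦⟧ᵖ : ∀ a p → ∂ a ⟦ p ⟧ᵖ ≈ ⟦ ∂ᵖ a p ⟧ᵖ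
  ∂-⟦⟧ᵖ a []            w = refl
  ∂-⟦⟧ᵖ a ((c , m) ∷ p) w = begin
    c * ⟦ m ⟧ᵐ (a ∷ w) + ⟦ p ⟧ᵖ (a ∷ w)
      ≡⟨ cong₂ _+_ (cong (c *_) (∂-⟦⟧ᵐ a m w)) (∂-⟦⟧ᵖ a p w) ⟩
    c * ⟦ ∂ᵐ a m ⟧ᵖ w + ⟦ ∂ᵖ a p ⟧ᵖ w
      ≡⟨ cong (_+ ⟦ ∂ᵖ a p ⟧ᵖ w) (⟦scale⟧ c (∂ᵐ a m) w) ⟨
    ⟦ scale c (∂ᵐ a m) ⟧ᵖ w + ⟦ ∂ᵖ a p ⟧ᵖ w
      ≡⟨ ⟦++⟧ᵖ (scale c (∂ᵐ a m)) (∂ᵖ a p) w ⟨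
    ⟦ ∂ᵖ a ((c , m) ∷ p) ⟧ᵖ w ∎
    where open ≡-Reasoning

  _≟ᵃ_ : DecidableEquality Atom
  letter a ≟ᵃ letter b = map′ (cong letter) (λ { refl → refl }) (a ≟L b)
  star a u ≟ᵃ star b v =
    map′ (λ (a≡b , u≡v) → cong₂ star a≡b u≡v) (λ { refl → refl , refl }) (a ≟L b ×-dec u ≟W v)
  letter _ ≟ᵃ star _ _ = no λ ()
  star _ _ ≟ᵃ letter _ = no λ ()

  _≟ᵐ_ : DecidableEquality Monomial
  _≟ᵐ_ = List.≡-dec _≟ᵃ_

  _≟ᵖ_ : DecidableEquality Poly
  _≟ᵖ_ = List.≡-dec (Product.≡-dec _≟_ _≟ᵐ_)

  insert : ℤ → Monomial → Poly → Poly
  insert c m []             = (c , m) ∷ []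
  insert c m ((d , m′) ∷ p) with m ≟ᵐ m′
  ... | yes _ = (c + d , m′) ∷ p
  ... | no  _ = (d , m′) ∷ insert c m p

  ⟦insert⟧ : ∀ c m p → ⟦ insert c m p ⟧ᵖ ≈ c · ⟦ m ⟧ᵐ ⊕ ⟦ p ⟧ᵖ
  ⟦insert⟧ c m []             w = refl
  ⟦insert⟧ c m ((d , m′) ∷ p) w with m ≟ᵐ m′
  ... | yes refl = merge c d (⟦ m ⟧ᵐ w) (⟦ p ⟧ᵖ w)
    where
    merge : ∀ c d x r → (c + d) * x + r ≡ c * x + (d * x + r)
    merge = solve-∀
  ... | no  _    =
    trans (cong (d * ⟦ m′ ⟧ᵐ w +_) (⟦insert⟧ c m p w)) (swap (d * ⟦ m′ ⟧ᵐ w) (c * ⟦ m ⟧ᵐ w) (⟦ p ⟧ᵖ w))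
    where
    swap : ∀ x y r → x + (y + r) ≡ y + (x + r)
    swap = solve-∀

  collect : Poly → Poly
  collect []            = []
  collect ((c , m) ∷ p) = insert c m (collect p)

  ⟦collect⟧ : ∀ p → ⟦ collect p ⟧ᵖ ≈ ⟦ p ⟧ᵖ
  ⟦collect⟧ []            w = refl
  ⟦collect⟧ ((c , m) ∷ p) w = trans (⟦insert⟧ c m (collect p) w) (cong (c * ⟦ m ⟧ᵐ w +_) (⟦collect⟧ p w))

  dropZeros : Poly → Poly
  dropZeros = filter λ (c , _) → ¬? (c ≟ 0ℤ)

  ⟦dropZeros⟧ : ∀ p → ⟦ dropZeros p ⟧ᵖ ≈ ⟦ p ⟧ᵖ
  ⟦dropZeros⟧ []            w = refl
  ⟦dropZeros⟧ ((c , m) ∷ p) w with c ≟ 0ℤ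
  ... | yes refl = trans (⟦dropZeros⟧ p w) (sym (+-identityˡ _))
  ... | no  _    = cong (c * ⟦ m ⟧ᵐ w +_) (⟦dropZeros⟧ p w)

  -- Collecting equal monomials and dropping zero terms is what lets the iterated derivatives
  -- of the expressions in the theorem take only finitely many values.
  normalize : Poly → Poly
  normalize = dropZeros ∘ collect

  ⟦normalize⟧ : ∀ p → ⟦ normalize p ⟧ᵖ ≈ ⟦ p ⟧ᵖ
  ⟦normalize⟧ p w = trans (⟦dropZeros⟧ (collect p) w) (⟦collect⟧ p w)

  infixl 7 _`⊛_
  infixl 6 _`⊕_ _`⊖_

  data Expr : Set where
    `one  : Expr
    `mono : Word → Expr
    `geom : Letter → Word → Expr
    _`⊕_ _`⊛_ _`⊖_ : Expr → Expr → Expr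

  ⟦_⟧ : Expr → Series
  ⟦ `one ⟧      = one
  ⟦ `mono u ⟧   = mono u
  ⟦ `geom b u ⟧ = geom (mono (b ∷ u))
  ⟦ e `⊕ e′ ⟧   = ⟦ e ⟧ ⊕ ⟦ e′ ⟧
  ⟦ e `⊛ e′ ⟧   = ⟦ e ⟧ ⊛ ⟦ e′ ⟧
  ⟦ e `⊖ e′ ⟧   = ⟦ e ⟧ ⊖ ⟦ e′ ⟧

  compile : Expr → Poly
  compile `one        = monomial []
  compile (`mono u)   = monomial (map letter u)
  compile (`geom b u) = monomial (star b u ∷ [])
  compile (e `⊕ e′)   = compile e ++ compile e′
  compile (e `⊛ e′)   = compile e ⊛ᵖ compile e′
  compile (e `⊖ e′)   = compile e ++ scale -1ℤ (compile e′)

  ⟦compile⟧ : ∀ e → ⟦ e ⟧ ≈ ⟦ compile e ⟧ᵖ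
  ⟦compile⟧ `one        w = sym (⟦monomial⟧ [] w)
  ⟦compile⟧ (`mono u)   w = sym (trans (⟦monomial⟧ (map letter u) w) (⟦word⟧ u w))
  ⟦compile⟧ (`geom b u) w = sym (trans (⟦monomial⟧ (star b u ∷ []) w) (⊛-identityʳ (geom (mono (b ∷ u))) w))
  ⟦compile⟧ (e `⊕ e′)   w =
    trans (cong₂ _+_ (⟦compile⟧ e w) (⟦compile⟧ e′ w)) (sym (⟦++⟧ᵖ (compile e) (compile e′) w))
  ⟦compile⟧ (e `⊛ e′)   w =
    trans (⊛-cong (⟦compile⟧ e) (⟦compile⟧ e′) w) (sym (⟦⊛ᵖ⟧ (compile e) (compile e′) w))
  ⟦compile⟧ (e `⊖ e′)   w = begin
    ⟦ e ⟧ w - ⟦ e′ ⟧ w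
      ≡⟨ cong₂ _-_ (⟦compile⟧ e w) (⟦compile⟧ e′ w) ⟩
    ⟦ compile e ⟧ᵖ w - ⟦ compile e′ ⟧ᵖ w
      ≡⟨ minus (⟦ compile e ⟧ᵖ w) (⟦ compile e′ ⟧ᵖ w) ⟩
    ⟦ compile e ⟧ᵖ w + -1ℤ * ⟦ compile e′ ⟧ᵖ w
      ≡⟨ cong (⟦ compile e ⟧ᵖ w +_) (⟦scale⟧ -1ℤ (compile e′) w) ⟨
    ⟦ compile e ⟧ᵖ w + ⟦ scale -1ℤ (compile e′) ⟧ᵖ w
      ≡⟨ ⟦++⟧ᵖ (compile e) (scale -1ℤ (compile e′)) w ⟨
    ⟦ compile (e `⊖ e′) ⟧ᵖ w ∎
    where
    open ≡-Reasoning
    minus : ∀ x y → x - y ≡ x + -1ℤ * y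
    minus = solve-∀

module PartitionSequences where

  open import Data.Nat using (_+_; _∸_; _≤_; _<_; _≥_; z≤n; s≤s; _≤?_)
  open import Data.Nat.Properties
    using (≤-refl; ≤-trans; <-≤-trans; ≤-<-trans; <⇒≤; <⇒≱; ≤-<-connex; m≤n⇒m≤1+n; m≤n⇒∃[o]m+o≡n;
           +-identityʳ; +-suc; +-∸-assoc; m∸n+n≡m; m∸n≤m; m∸[m∸n]≡n; m<n⇒0<n∸m; ∸-monoʳ-<; n∸n≡0)
  open import Data.Nat.Tactic.RingSolver using (solve-∀)
  open import Data.List using (replicate; take)
  open import Data.List.Properties using (filter-accept; filter-none; ++-assoc; ++-identityʳ)
  open import Data.List.Relation.Unary.All as All using (All; []; _∷_)
  open import Data.List.Relation.Unary.Linked using (Linked; []; [-]; _∷_; tail)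
  open import Data.List.Relation.Unary.Linked.Properties using (Linked⇒AllPairs)
  open import Data.List.Relation.Unary.AllPairs using (_∷_)
  open import Data.List.Membership.Propositional using (_∈_)
  open import Data.List.Membership.Propositional.Properties using (∈-map⁺; ∈-map⁻; ∈-upTo⁺; ∈-upTo⁻)
  open import Data.Product using (∃-syntax)
  open import Data.Sum using (inj₁; inj₂)
  open import Function using (flip)
  open import Function.Bundles using (_⇔_; mk⇔; Equivalence)

  Decreasing : List ℕ → Set
  Decreasing = Linked _≥_

  ≤-head : ∀ {xs} → Decreasing xs → All (_≤ headOr0 xs) xs
  ≤-head {[]}    _   = []
  ≤-head {x ∷ _} dec with Linked⇒AllPairs (flip ≤-trans) dec
  ... | below-x ∷ _ = ≤-refl ∷ below-x

  head-≤ : ∀ {r rs} → Decreasing (r ∷ rs) → headOr0 rs ≤ r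
  head-≤ {rs = []}    _         = z≤n
  head-≤ {rs = _ ∷ _} (s≤r ∷ _) = s≤r

  letterAt : Word → ℕ → Letter
  letterAt []      _       = X
  letterAt (a ∷ _) zero    = a
  letterAt (_ ∷ u) (suc i) = letterAt u i

  letterAt-Yᵏ-< : ∀ {k i} l → i < k → letterAt (replicate k Y ++ l) i ≡ Y
  letterAt-Yᵏ-< {suc k} {zero}  l _         = refl
  letterAt-Yᵏ-< {suc k} {suc i} l (s≤s i<k) = letterAt-Yᵏ-< l i<k

  letterAt-Yᵏ-+ : ∀ k l i → letterAt (replicate k Y ++ l) (k + i) ≡ letterAt l i
  letterAt-Yᵏ-+ zero    l i = refl
  letterAt-Yᵏ-+ (suc k) l i = letterAt-Yᵏ-+ k l i

  letterAt-take : ∀ {n} u {i} → i < n → letterAt (take n u) i ≡ letterAt u i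
  letterAt-take {suc n} []      _         = refl
  letterAt-take (a ∷ u) {zero}  (s≤s _)   = refl
  letterAt-take (a ∷ u) {suc i} (s≤s i<n) = letterAt-take u i<n

  letterAt-Xⁿ : ∀ n i → letterAt (replicate n X) i ≡ X
  letterAt-Xⁿ zero    i       = refl
  letterAt-Xⁿ (suc n) zero    = refl
  letterAt-Xⁿ (suc n) (suc i) = letterAt-Xⁿ n i

  letterAt-++-Xⁿ : ∀ u n i → letterAt (u ++ replicate n X) i ≡ letterAt u i
  letterAt-++-Xⁿ []      n i       = letterAt-Xⁿ n i
  letterAt-++-Xⁿ (a ∷ u) n zero    = refl
  letterAt-++-Xⁿ (a ∷ u) n (suc i) = letterAt-++-Xⁿ u n i

  take-take-suc : ∀ n (u : Word) → take n (take (suc n) u) ≡ take n u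
  take-take-suc zero    u       = refl
  take-take-suc (suc n) []      = refl
  take-take-suc (suc n) (a ∷ u) = cong (a ∷_) (take-take-suc n u)

  reversedM : List ℕ → Word
  reversedM []       = []
  reversedM (r ∷ rs) = X ∷ (replicate (r ∸ headOr0 rs) Y ++ reversedM rs)

  hookLength : ℕ → List ℕ → ℕ → ℕ
  hookLength r rs j = suc (r ∸ j) + countGe j rs

  HookInRow : ℕ → List ℕ → ℕ → Set
  HookInRow r rs h = ∃[ j ] (1 ≤ j × j ≤ r × hookLength r rs j ≡ h)

  ∈-rowHooks⇔HookInRow : ∀ r rs h → h ∈ rowHooks r rs ⇔ HookInRow r rs h
  ∈-rowHooks⇔HookInRow r rs h = mk⇔ to from
    where
    to : h ∈ rowHooks r rs → HookInRow r rs h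
    to h∈ with ∈-map⁻ (hookLength r rs) h∈
    ... | j , j∈ , refl with ∈-map⁻ suc j∈
    ... | i , i∈ , refl = suc i , s≤s z≤n , ∈-upTo⁻ i∈ , refl
    from : HookInRow r rs h → h ∈ rowHooks r rs
    from (suc i , _ , s≤s i<r , refl) = ∈-map⁺ (hookLength r rs) (∈-map⁺ suc (∈-upTo⁺ (s≤s i<r)))

  hookLength-above : ∀ r {rs j} → Decreasing rs → headOr0 rs < j → hookLength r rs j ≡ suc (r ∸ j)
  hookLength-above r {rs} {j} dec head<j =
    trans (cong (suc (r ∸ j) +_) (cong length (filter-none (j ≤?_) (All.map below (≤-head dec)))))
          (+-identityʳ _)
    where
    below : ∀ {x} → x ≤ headOr0 rs → ¬ j ≤ x
    below x≤head = <⇒≱ (≤-<-trans x≤head head<j)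

  hookLength-below : ∀ {r s} ss {j} → j ≤ s → s ≤ r →
                     hookLength r (s ∷ ss) j ≡ suc ((r ∸ s) + hookLength s ss j)
  hookLength-below {r} {s} ss {j} j≤s s≤r = begin
    suc (r ∸ j) + countGe j (s ∷ ss)
      ≡⟨ cong (suc (r ∸ j) +_) (cong length (filter-accept (j ≤?_) j≤s)) ⟩
    suc (r ∸ j) + suc (countGe j ss)
      ≡⟨ cong (λ d → suc d + suc (countGe j ss)) r∸j≡ ⟩
    suc ((r ∸ s) + (s ∸ j)) + suc (countGe j ss)
      ≡⟨ regroup (r ∸ s) (s ∸ j) (countGe j ss) ⟩
    suc ((r ∸ s) + (suc (s ∸ j) + countGe j ss)) ∎
    where
    open ≡-Reasoning
    r∸j≡ : r ∸ j ≡ (r ∸ s) + (s ∸ j)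
    r∸j≡ = trans (cong (_∸ j) (sym (m∸n+n≡m s≤r))) (+-∸-assoc (r ∸ s) j≤s)
    regroup : ∀ a b c → suc (a + b) + suc c ≡ suc (a + (suc b + c))
    regroup = solve-∀

  <∸-swap : ∀ {i r s} → i < r ∸ s → s < r ∸ i
  <∸-swap {i} {r}     {zero}  i<r = m<n⇒0<n∸m i<r
  <∸-swap {i} {suc r} {suc s} i<r∸s =
    subst (suc s <_) (sym (+-∸-assoc 1 (<⇒≤ (<-≤-trans i<r∸s (m∸n≤m r s))))) (s≤s (<∸-swap i<r∸s))

  Y-at-hook : ∀ {r rs j} → Decreasing (r ∷ rs) → 1 ≤ j → j ≤ r →
              letterAt (reversedM (r ∷ rs)) (hookLength r rs j) ≡ Y
  Y-at-hook {r} {rs} {j} dec 1≤j j≤r with ≤-<-connex j (headOr0 rs)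
  Y-at-hook {rs = []}                 dec (s≤s z≤n) j≤r | inj₁ ()
  Y-at-hook {r} {s ∷ ss} {j} (s≤r ∷ dec) 1≤j j≤r | inj₁ j≤s = begin
    letterAt (reversedM (r ∷ s ∷ ss)) (hookLength r (s ∷ ss) j)
      ≡⟨ cong (letterAt (reversedM (r ∷ s ∷ ss))) (hookLength-below ss j≤s s≤r) ⟩
    letterAt (reversedM (r ∷ s ∷ ss)) (suc ((r ∸ s) + hookLength s ss j))
      ≡⟨ letterAt-Yᵏ-+ (r ∸ s) (reversedM (s ∷ ss)) _ ⟩
    letterAt (reversedM (s ∷ ss)) (hookLength s ss j)
      ≡⟨ Y-at-hook dec 1≤j j≤s ⟩
    Y ∎
    where open ≡-Reasoning
  Y-at-hook {r} {rs} {j} dec 1≤j j≤r | inj₂ head<j = begin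
    letterAt (reversedM (r ∷ rs)) (hookLength r rs j)
      ≡⟨ cong (letterAt (reversedM (r ∷ rs))) (hookLength-above r (tail dec) head<j) ⟩
    letterAt (reversedM (r ∷ rs)) (suc (r ∸ j))
      ≡⟨ letterAt-Yᵏ-< (reversedM rs) (∸-monoʳ-< head<j j≤r) ⟩
    Y ∎
    where open ≡-Reasoning

  hook-at-Y : ∀ {r rs} h → Decreasing (r ∷ rs) → letterAt (reversedM (r ∷ rs)) h ≡ Y → HookInRow r rs h
  hook-at-Y zero    _   ()
  hook-at-Y {r} {rs} (suc i) dec Y-at with ≤-<-connex (r ∸ headOr0 rs) i
  ... | inj₂ i<k = r ∸ i , m<n⇒0<n∸m i<r , m∸n≤m r i , hook≡
    where
    i<r : i < r
    i<r = <-≤-trans i<k (m∸n≤m r (headOr0 rs))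
    hook≡ : hookLength r rs (r ∸ i) ≡ suc i
    hook≡ = trans (hookLength-above r (tail dec) (<∸-swap i<k)) (cong suc (m∸[m∸n]≡n (<⇒≤ i<r)))
  ... | inj₁ k≤i with m≤n⇒∃[o]m+o≡n k≤i
  hook-at-Y {r} {[]} (suc .(r + i′)) dec Y-at | inj₁ _ | i′ , refl
    with () ← trans (sym (letterAt-Yᵏ-+ r [] i′)) Y-at
  hook-at-Y {r} {s ∷ ss} (suc .((r ∸ s) + i′)) (s≤r ∷ dec) Y-at | inj₁ _ | i′ , refl
    with j , 1≤j , j≤s , refl ← hook-at-Y i′ dec (trans (sym (letterAt-Yᵏ-+ (r ∸ s) (reversedM (s ∷ ss)) i′)) Y-at)
    = j , 1≤j , ≤-trans j≤s s≤r , hookLength-below ss j≤s s≤r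

  ∈-rowHooks⇔Y-at : ∀ {r rs} → Decreasing (r ∷ rs) → ∀ h →
                    h ∈ rowHooks r rs ⇔ letterAt (reversedM (r ∷ rs)) h ≡ Y
  ∈-rowHooks⇔Y-at {r} {rs} dec h = mk⇔
    (λ h∈ → let j , 1≤j , j≤r , hook≡h = Equivalence.to (∈-rowHooks⇔HookInRow r rs h) h∈
            in subst (λ h → letterAt (reversedM (r ∷ rs)) h ≡ Y) hook≡h (Y-at-hook dec 1≤j j≤r))
    (Equivalence.from (∈-rowHooks⇔HookInRow r rs h) ∘ hook-at-Y h dec)

  parse : ℕ → List ℕ → Word → List ℕ
  parse n rows []      = rows
  parse n rows (Y ∷ w) = parse (suc n) rows w
  parse n rows (X ∷ w) = parse n (n ∷ rows) w

  replicate-++-∷ : ∀ k (a : Letter) w → a ∷ (replicate k a ++ w) ≡ replicate k a ++ (a ∷ w)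
  replicate-++-∷ zero    a w = refl
  replicate-++-∷ (suc k) a w = cong (a ∷_) (replicate-++-∷ k a w)

  parse-Yᵏ : ∀ k n rows w → parse n rows (replicate k Y ++ w) ≡ parse (k + n) rows w
  parse-Yᵏ zero    n rows w = refl
  parse-Yᵏ (suc k) n rows w = trans (parse-Yᵏ k (suc n) rows w) (cong (λ m → parse m rows w) (+-suc k n))

  IsPartition-tail : ∀ {r rs} → IsPartition (r ∷ rs) → IsPartition rs
  IsPartition-tail (dec , pos) = tail dec , All.tail pos

  parse-M-++ : ∀ {μ} v → IsPartition μ → parse 0 [] (M μ ++ v) ≡ parse (headOr0 μ) μ v
  parse-M-++ {[]}     v _ = refl
  parse-M-++ {r ∷ rs} v μ-part = begin
    parse 0 [] ((M rs ++ (Yᵏ ++ X ∷ [])) ++ v)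
      ≡⟨ cong (parse 0 []) (++-assoc (M rs) (Yᵏ ++ X ∷ []) v) ⟩
    parse 0 [] (M rs ++ ((Yᵏ ++ X ∷ []) ++ v))
      ≡⟨ parse-M-++ ((Yᵏ ++ X ∷ []) ++ v) (IsPartition-tail μ-part) ⟩
    parse h rs ((Yᵏ ++ X ∷ []) ++ v)
      ≡⟨ cong (parse h rs) (++-assoc Yᵏ (X ∷ []) v) ⟩
    parse h rs (Yᵏ ++ X ∷ v)
      ≡⟨ parse-Yᵏ (r ∸ h) h rs (X ∷ v) ⟩
    parse ((r ∸ h) + h) rs (X ∷ v)
      ≡⟨ cong (λ m → parse m rs (X ∷ v)) (m∸n+n≡m (head-≤ (proj₁ μ-part))) ⟩
    parse r (r ∷ rs) v ∎
    where
    open ≡-Reasoning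
    h  = headOr0 rs
    Yᵏ = replicate (r ∸ h) Y

  parse-M : ∀ {μ} → IsPartition μ → parse 0 [] (M μ) ≡ μ
  parse-M {μ} μ-part = trans (cong (parse 0 []) (sym (++-identityʳ (M μ)))) (parse-M-++ [] μ-part)

  M-parse : ∀ w n rows → headOr0 rows ≤ n →
            M (parse n rows (w ++ X ∷ [])) ≡ M rows ++ (replicate (n ∸ headOr0 rows) Y ++ (w ++ X ∷ []))
  M-parse []      n rows _      = refl
  M-parse (Y ∷ w) n rows head≤n = begin
    M (parse (suc n) rows (w ++ X ∷ []))
      ≡⟨ M-parse w (suc n) rows (m≤n⇒m≤1+n head≤n) ⟩
    M rows ++ (replicate (suc n ∸ h) Y ++ (w ++ X ∷ []))
      ≡⟨ cong (λ k → M rows ++ (replicate k Y ++ (w ++ X ∷ []))) (+-∸-assoc 1 head≤n) ⟩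
    M rows ++ (replicate (suc (n ∸ h)) Y ++ (w ++ X ∷ []))
      ≡⟨ cong (M rows ++_) (replicate-++-∷ (n ∸ h) Y (w ++ X ∷ [])) ⟩
    M rows ++ (replicate (n ∸ h) Y ++ (Y ∷ w ++ X ∷ [])) ∎
    where
    open ≡-Reasoning
    h = headOr0 rows
  M-parse (X ∷ w) n rows head≤n = begin
    M (parse n (n ∷ rows) (w ++ X ∷ []))
      ≡⟨ M-parse w n (n ∷ rows) ≤-refl ⟩
    M (n ∷ rows) ++ (replicate (n ∸ n) Y ++ (w ++ X ∷ []))
      ≡⟨ cong (λ k → M (n ∷ rows) ++ (replicate k Y ++ (w ++ X ∷ []))) (n∸n≡0 n) ⟩
    (M rows ++ (replicate (n ∸ headOr0 rows) Y ++ X ∷ [])) ++ (w ++ X ∷ [])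
      ≡⟨ ++-assoc (M rows) _ _ ⟩
    M rows ++ ((replicate (n ∸ headOr0 rows) Y ++ X ∷ []) ++ (w ++ X ∷ []))
      ≡⟨ cong (M rows ++_) (++-assoc (replicate (n ∸ headOr0 rows) Y) (X ∷ []) _) ⟩
    M rows ++ (replicate (n ∸ headOr0 rows) Y ++ (X ∷ w ++ X ∷ [])) ∎
    where open ≡-Reasoning

  parse-IsPartition : ∀ w n rows → IsPartition rows → headOr0 rows ≤ n → 0 < n → IsPartition (parse n rows w)
  parse-IsPartition []      n rows rows-part _      _   = rows-part
  parse-IsPartition (Y ∷ w) n rows rows-part head≤n _   =
    parse-IsPartition w (suc n) rows rows-part (m≤n⇒m≤1+n head≤n) (s≤s z≤n)
  parse-IsPartition (X ∷ w) n rows (dec , pos) head≤n 0<n =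
    parse-IsPartition w n (n ∷ rows) (cons-dec rows dec head≤n , 0<n ∷ pos) ≤-refl 0<n
    where
    cons-dec : ∀ rows → Decreasing rows → headOr0 rows ≤ n → Decreasing (n ∷ rows)
    cons-dec []      _   _      = [-]
    cons-dec (_ ∷ _) dec head≤n = head≤n ∷ dec

module Bisimulation {S : Set} (_≟S_ : DecidableEquality S) (δ : S → Letter → S) (accepting : S → Bool) where

  open SeriesAlgebra
  open RationalExpressions
  open import Relation.Nullary using (_×-dec_)
  open import Data.Integer using (ℤ; 0ℤ; 1ℤ; _≟_)
  open import Data.List using (concatMap)
  open import Data.List.Membership.Propositional.Properties using (∈-++⁺ˡ)
  open import Data.List.Relation.Unary.All as All using (All; []; _∷_; all?)
  open import Data.List.Relation.Unary.Any using (here; there)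
  open import Data.List.Membership.Propositional using (_∈_)
  import Data.Product.Properties as Product
  open import Data.List.Membership.DecPropositional (Product.≡-dec _≟S_ _≟ᵖ_) using (_∈?_)

  run : S → Word → S
  run s []      = s
  run s (a ∷ w) = run (δ s a) w

  run-++ : ∀ s u v → run s (u ++ v) ≡ run (run s u) v
  run-++ s []      v = refl
  run-++ s (a ∷ u) v = run-++ (δ s a) u v

  indicator : Bool → ℤ
  indicator true  = 1ℤ
  indicator false = 0ℤ

  letters : List Letter
  letters = X ∷ Y ∷ []

  ∈-letters : ∀ a → a ∈ letters
  ∈-letters X = here refl
  ∈-letters Y = there (here refl)

  step : S × Poly → Letter → S × Poly
  step (s , p) a = δ s a , normalize (∂ᵖ a p)

  Consistent : List (S × Poly) → S × Poly → Set
  Consistent R (s , p) = νᵖ p ≡ indicator (accepting s) × All (λ a → step (s , p) a ∈ R) letters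

  IsBisimulation : List (S × Poly) → Set
  IsBisimulation R = All (Consistent R) R

  isBisimulation? : ∀ R → Dec (IsBisimulation R)
  isBisimulation? R =
    all? (λ (s , p) → νᵖ p ≟ indicator (accepting s) ×-dec all? (λ a → step (s , p) a ∈? R) letters) R

  ⟦⟧ᵖ≡indicator : ∀ {R} → IsBisimulation R → ∀ {s p} → (s , p) ∈ R →
                  ∀ w → ⟦ p ⟧ᵖ w ≡ indicator (accepting (run s w))
  ⟦⟧ᵖ≡indicator bisim {s} {p} sp∈R []      = trans (⟦⟧ᵖ-[] p) (proj₁ (All.lookup bisim sp∈R))
  ⟦⟧ᵖ≡indicator bisim {s} {p} sp∈R (a ∷ w) = begin
    ⟦ p ⟧ᵖ (a ∷ w)
      ≡⟨ ∂-⟦⟧ᵖ a p w ⟩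
    ⟦ ∂ᵖ a p ⟧ᵖ w
      ≡⟨ ⟦normalize⟧ (∂ᵖ a p) w ⟨
    ⟦ normalize (∂ᵖ a p) ⟧ᵖ w
      ≡⟨ ⟦⟧ᵖ≡indicator bisim (All.lookup (proj₂ (All.lookup bisim sp∈R)) (∈-letters a)) w ⟩
    indicator (accepting (run (δ s a) w)) ∎
    where open ≡-Reasoning

  fresh : List (S × Poly) → List (S × Poly) → List (S × Poly)
  fresh R []       = []
  fresh R (x ∷ xs) with x ∈? R
  ... | yes _ = fresh R xs
  ... | no  _ = x ∷ fresh (x ∷ R) xs

  saturate : ℕ → List (S × Poly) → List (S × Poly)
  saturate zero    R = R
  saturate (suc n) R with fresh R (concatMap (λ x → map (step x) letters) R)
  ... | []  = R
  ... | new = saturate n (R ++ new)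

  ⊆-saturate : ∀ n {x R} → x ∈ R → x ∈ saturate n R
  ⊆-saturate zero    x∈R = x∈R
  ⊆-saturate (suc n) {R = R} x∈R with fresh R (concatMap (λ x → map (step x) letters) R)
  ... | []    = x∈R
  ... | _ ∷ _ = ⊆-saturate n (∈-++⁺ˡ x∈R)

module CoreAutomaton (q : ℕ) where

  open PartitionSequences
  open import Data.Nat.Properties using (≤-refl)
  open import Data.Nat using (_∸_; s≤s; z≤n)
  open import Data.List using (take; replicate)
  open import Data.List.Relation.Unary.All using ([]; _∷_)
  open import Data.List.Relation.Unary.Linked using ([])
  open import Data.List.Membership.Propositional.Properties using (∈-++⁺ˡ; ∈-++⁺ʳ; ∈-++⁻)
  open import Data.Sum using (_⊎_; inj₁; inj₂)
  open import Data.Product using (∃-syntax)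
  open import Function.Bundles using (_⇔_; mk⇔; Equivalence)

  data State : Set where
    start dead : State
    window     : Word → State

  _≟S_ : DecidableEquality State
  start    ≟S start    = yes refl
  dead     ≟S dead     = yes refl
  window u ≟S window v = map′ (cong window) (λ { refl → refl }) (u ≟W v)
  start    ≟S dead     = no λ ()
  start    ≟S window _ = no λ ()
  dead     ≟S start    = no λ ()
  dead     ≟S window _ = no λ ()
  window _ ≟S start    = no λ ()
  window _ ≟S dead     = no λ ()

  -- A window holds the last q + 1 letters read, most recent first; letters before the start
  -- of the word count as X, which never starts a hook.
  pad : Word → Word
  pad u = take (suc q) (u ++ replicate (suc q) X)

  afterX : Letter → Word → State
  afterX Y u = dead
  afterX X u = window (take (suc q) (X ∷ u))

  δ : State → Letter → State
  δ start      Y = window (pad (Y ∷ []))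
  δ start      X = dead
  δ dead       _ = dead
  δ (window u) Y = window (take (suc q) (Y ∷ u))
  δ (window u) X = afterX (letterAt u q) u

  accepting : State → Bool
  accepting start            = true
  accepting dead             = false
  accepting (window (X ∷ _)) = true
  accepting (window _)       = false

  open Bisimulation _≟S_ δ accepting public

  take-pad : ∀ a l → take (suc q) (a ∷ pad l) ≡ pad (a ∷ l)
  take-pad a l = cong (a ∷_) (take-take-suc q (l ++ replicate (suc q) X))

  letterAt-pad : ∀ l → letterAt (pad l) q ≡ letterAt l q
  letterAt-pad l = trans (letterAt-take (l ++ replicate (suc q) X) ≤-refl) (letterAt-++-Xⁿ l (suc q) q)

  run-dead : ∀ w → run dead w ≡ dead
  run-dead []      = refl
  run-dead (_ ∷ w) = run-dead w

  run-Yᵏ : ∀ k l → run (window (pad l)) (replicate k Y) ≡ window (pad (replicate k Y ++ l))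
  run-Yᵏ zero    l = refl
  run-Yᵏ (suc k) l = begin
    run (window (take (suc q) (Y ∷ pad l))) (replicate k Y)
      ≡⟨ cong (λ u → run (window u) (replicate k Y)) (take-pad Y l) ⟩
    run (window (pad (Y ∷ l))) (replicate k Y)
      ≡⟨ run-Yᵏ k (Y ∷ l) ⟩
    window (pad (replicate k Y ++ Y ∷ l))
      ≡⟨ cong (window ∘ pad) (replicate-++-∷ k Y l) ⟨
    window (pad (Y ∷ replicate k Y ++ l)) ∎
    where open ≡-Reasoning

  stateOf : List ℕ → State
  stateOf []         = start
  stateOf rs@(_ ∷ _) = window (pad (reversedM rs))

  accepting-stateOf : ∀ rs → accepting (stateOf rs) ≡ true
  accepting-stateOf []      = refl
  accepting-stateOf (_ ∷ _) = refl

  run-stateOf-Yᵏ : ∀ {r rs} → IsPartition (r ∷ rs) →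
                   let Yᵏ = replicate (r ∸ headOr0 rs) Y in
                   run (stateOf rs) Yᵏ ≡ window (pad (Yᵏ ++ reversedM rs))
  run-stateOf-Yᵏ {rs = []}     (_ , s≤s {n = r′} _ ∷ _) =
    trans (run-Yᵏ r′ (Y ∷ [])) (cong (window ∘ pad) (sym (replicate-++-∷ r′ Y [])))
  run-stateOf-Yᵏ {r} {s ∷ ss} _                        = run-Yᵏ (r ∸ s) (reversedM (s ∷ ss))

  run-row : ∀ {r rs} → IsPartition (r ∷ rs) → run start (M rs) ≡ stateOf rs →
            let L = replicate (r ∸ headOr0 rs) Y ++ reversedM rs in
            run start (M (r ∷ rs)) ≡ afterX (letterAt L q) (pad L)
  run-row {r} {rs} μ-part run≡ = begin
    run start (M rs ++ (Yᵏ ++ X ∷ []))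
      ≡⟨ run-++ start (M rs) (Yᵏ ++ X ∷ []) ⟩
    run (run start (M rs)) (Yᵏ ++ X ∷ [])
      ≡⟨ cong (λ s → run s (Yᵏ ++ X ∷ [])) run≡ ⟩
    run (stateOf rs) (Yᵏ ++ X ∷ [])
      ≡⟨ run-++ (stateOf rs) Yᵏ (X ∷ []) ⟩
    run (run (stateOf rs) Yᵏ) (X ∷ [])
      ≡⟨ cong (λ s → run s (X ∷ [])) (run-stateOf-Yᵏ μ-part) ⟩
    δ (window (pad L)) X
      ≡⟨ cong (λ b → afterX b (pad L)) (letterAt-pad L) ⟩
    afterX (letterAt L q) (pad L) ∎
    where
    open ≡-Reasoning
    Yᵏ = replicate (r ∸ headOr0 rs) Y
    L  = Yᵏ ++ reversedM rs

  run-M : ∀ {μ} → IsPartition μ →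
          (IsCore (suc q) μ × run start (M μ) ≡ stateOf μ) ⊎ (¬ IsCore (suc q) μ × run start (M μ) ≡ dead)
  run-M {[]}     _      = inj₁ ((λ ()) , refl)
  run-M {r ∷ rs} μ-part with run-M (IsPartition-tail μ-part)
  ... | inj₂ (not-core , run≡dead) = inj₂ (not-core ∘ core-tail , run≡)
    where
    core-tail : IsCore (suc q) (r ∷ rs) → IsCore (suc q) rs
    core-tail core = core ∘ ∈-++⁺ʳ (rowHooks r rs)
    row = replicate (r ∸ headOr0 rs) Y ++ X ∷ []
    run≡ : run start (M (r ∷ rs)) ≡ dead
    run≡ = trans (run-++ start (M rs) row) (trans (cong (λ s → run s row) run≡dead) (run-dead row))
  ... | inj₁ (core , run≡state) with letterAt (reversedM (r ∷ rs)) (suc q) in Y-or-X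
  ...   | Y = inj₂ (not-core , trans (run-row μ-part run≡state) (cong (λ b → afterX b (pad L)) Y-or-X))
    where
    L = replicate (r ∸ headOr0 rs) Y ++ reversedM rs
    not-core : ¬ IsCore (suc q) (r ∷ rs)
    not-core core′ = core′ (∈-++⁺ˡ (Equivalence.from (∈-rowHooks⇔Y-at (proj₁ μ-part) (suc q)) Y-or-X))
  ...   | X = inj₁ (core′ , trans (run-row μ-part run≡state)
                                  (trans (cong (λ b → afterX b (pad L)) Y-or-X) (cong window (take-pad X L))))
    where
    L = replicate (r ∸ headOr0 rs) Y ++ reversedM rs
    core′ : IsCore (suc q) (r ∷ rs)
    core′ p∈ with ∈-++⁻ (rowHooks r rs) p∈
    ... | inj₁ p∈row with () ← trans (sym Y-or-X) (Equivalence.to (∈-rowHooks⇔Y-at (proj₁ μ-part) (suc q)) p∈row)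
    ... | inj₂ p∈rs = core p∈rs

  accepts-M⇔IsCore : ∀ {μ} → IsPartition μ → accepting (run start (M μ)) ≡ true ⇔ IsCore (suc q) μ
  accepts-M⇔IsCore {μ} μ-part with run-M μ-part
  ... | inj₁ (core , run≡)     = mk⇔ (λ _ → core) (λ _ → trans (cong accepting run≡) (accepting-stateOf μ))
  ... | inj₂ (not-core , run≡) = mk⇔ (λ acc → case trans (sym (cong accepting run≡)) acc of λ ()) (⊥-elim ∘ not-core)

  ends-in-X : ∀ u a w → accepting (run (window u) (a ∷ w)) ≡ true → ∃[ v ] (a ∷ w ≡ v ++ X ∷ [])
  ends-in-X u Y []      ()
  ends-in-X u X []      _   = [] , refl
  ends-in-X u Y (b ∷ w) acc with v , eq ← ends-in-X (take (suc q) (Y ∷ u)) b w acc = Y ∷ v , cong (Y ∷_) eq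
  ends-in-X u X (b ∷ w) acc with letterAt u q
  ... | X with v , eq ← ends-in-X (take (suc q) (X ∷ u)) b w acc = X ∷ v , cong (X ∷_) eq
  ... | Y with () ← trans (sym (cong accepting (run-dead (b ∷ w)))) acc

  accepted-shape : ∀ w → accepting (run start w) ≡ true → w ≡ [] ⊎ ∃[ v ] (w ≡ Y ∷ v ++ X ∷ [])
  accepted-shape []          _   = inj₁ refl
  accepted-shape (X ∷ w)     acc with () ← trans (sym (cong accepting (run-dead w))) acc
  accepted-shape (Y ∷ [])    ()
  accepted-shape (Y ∷ b ∷ w) acc with v , eq ← ends-in-X (pad (Y ∷ [])) b w acc = inj₂ (v , cong (Y ∷_) eq)

  accepted⇒M-parse : ∀ w → accepting (run start w) ≡ true → IsPartition (parse 0 [] w) × M (parse 0 [] w) ≡ w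
  accepted⇒M-parse w acc with accepted-shape w acc
  ... | inj₁ refl       = ([] , []) , refl
  ... | inj₂ (v , refl) = parse-IsPartition (v ++ X ∷ []) 1 [] ([] , []) z≤n (s≤s z≤n) , M-parse v 1 [] z≤n

module _ (q : ℕ) (e : RationalExpressions.Expr) where

  open SeriesAlgebra
  open RationalExpressions
  open PartitionSequences using (parse; parse-M)
  open CoreAutomaton q
  open import Data.List.Relation.Unary.Any using (here)
  open import Data.List.Relation.Unary.All using ([])
  open import Data.List.Relation.Unary.AllPairs using ([]; _∷_)
  open import Data.List.Membership.Propositional using (_∈_)
  open import Function.Bundles using (mk⇔; Equivalence)
  open import Relation.Nullary.Decidable using (True; toWitness)

  ⟦⟧≡indicator : ∀ {R} → IsBisimulation R → (start , compile e) ∈ R →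
                 ∀ w → ⟦ e ⟧ w ≡ indicator (accepting (run start w))
  ⟦⟧≡indicator bisim e∈R w = trans (⟦compile⟧ e w) (⟦⟧ᵖ≡indicator bisim e∈R w)

  coreSum-by-bisimulation : ∀ {R} → IsBisimulation R → (start , compile e) ∈ R → CoreSumEquals (suc q) ⟦ e ⟧
  coreSum-by-bisimulation bisim e∈R w with accepting (run start w) in acc
  ... | true  = parse 0 [] w ∷ [] , [] ∷ [] , (λ μ → mk⇔ (to μ) (from μ)) ,
                trans (⟦⟧≡indicator bisim e∈R w) (cong indicator acc)
    where
    to : ∀ μ → μ ∈ parse 0 [] w ∷ [] → IsPartition μ × IsCore (suc q) μ × M μ ≡ w
    to μ (here refl) with part , M≡w ← accepted⇒M-parse w acc =
      part , Equivalence.to (accepts-M⇔IsCore part) (subst (λ u → accepting (run start u) ≡ true) (sym M≡w) acc) , M≡w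
    from : ∀ μ → IsPartition μ × IsCore (suc q) μ × M μ ≡ w → μ ∈ parse 0 [] w ∷ []
    from μ (μ-part , _ , refl) = here (sym (parse-M μ-part))
  ... | false = [] , [] , (λ μ → mk⇔ (λ ()) (from μ)) , trans (⟦⟧≡indicator bisim e∈R w) (cong indicator acc)
    where
    from : ∀ μ → IsPartition μ × IsCore (suc q) μ × M μ ≡ w → μ ∈ []
    from μ (μ-part , core , refl) = case trans (sym acc) (Equivalence.from (accepts-M⇔IsCore μ-part) core) of λ ()

  -- Only an upper bound: saturation stops at its fixpoint, and isBisimulation? checks the result.
  saturationRounds : ℕ
  saturationRounds = 20

  derivatives : List (State × Poly)
  derivatives = saturate saturationRounds ((start , compile e) ∷ [])

  coreSum-by-saturation : {True (isBisimulation? derivatives)} → CoreSumEquals (suc q) ⟦ e ⟧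
  coreSum-by-saturation {certificate} =
    coreSum-by-bisimulation (toWitness certificate) (⊆-saturate saturationRounds {R = (start , compile e) ∷ []} (here refl))

mainTheorem5 : CoreSumEquals 2 (geom (mono (Y ∷ X ∷ [])))
    × CoreSumEquals 3 (geom (mono (Y ∷ X ∷ X ∷ [])) ⊛ (one ⊕ mono (Y ∷ X ∷ [])) ⊛ geom (mono (Y ∷ Y ∷ X ∷ [])))
    × CoreSumEquals 4 (geom (mono (Y ∷ X ∷ X ∷ X ∷ []))
        ⊛ (geom (mono (Y ∷ X ∷ [])) ⊕ (one ⊕ mono (Y ∷ X ∷ X ∷ [])) ⊛ geom (mono (Y ∷ Y ∷ X ∷ X ∷ [])) ⊛ (one ⊕ mono (Y ∷ Y ∷ X ∷ [])) ⊖ one)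
        ⊛ geom (mono (Y ∷ Y ∷ Y ∷ X ∷ [])))
mainTheorem5 =
    coreSum-by-saturation 1 (`geom Y (X ∷ []))
  , coreSum-by-saturation 2 (`geom Y (X ∷ X ∷ []) `⊛ (`one `⊕ `mono (Y ∷ X ∷ [])) `⊛ `geom Y (Y ∷ X ∷ []))
  , coreSum-by-saturation 3
      (`geom Y (X ∷ X ∷ X ∷ [])
        `⊛ (`geom Y (X ∷ [])
              `⊕ (`one `⊕ `mono (Y ∷ X ∷ X ∷ [])) `⊛ `geom Y (Y ∷ X ∷ X ∷ []) `⊛ (`one `⊕ `mono (Y ∷ Y ∷ X ∷ []))
              `⊖ `one)
        `⊛ `geom Y (Y ∷ Y ∷ X ∷ []))
  where open RationalExpressions
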